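{- Let $r,t\ge 2$. Let $G$ be an $r$-graph with at least $t(r-1)+1$ vertices that does not contain $L^r_t$ as a subgraph and covers pairs. Let $x\in V(G)$. Then the link $L_G(x)$ does not contain $K^{r-1}_{t(r-1)-1}$. In particular, $G$ does not contain $K^r_{t(r-1)}$.
   Context: An $r$-graph is a vertex set with a family of $r$-element subsets (edges). $K^s_p$ is the complete $s$-graph on $p$ vertices. The linear star $L^r_t$ is the $r$-graph with $t$ edges all containing a common vertex and pairwise disjoint outside it. $G$ covers pairs if every pair of its vertices lies in some edge. The link of $x$ is the $(r-1)$-graph $L_G(x)=\{e\subseteq V(G)\setminus\{x\}: e\cup\{x\}\in E(G)\}$. -}

module Defs where

open import Data.Nat using (ℕ)
open import Data.Fin using (Fin)
open import Data.Fin.Subset using (Subset; _∈_; _∉_; _⊆_; _∩_; _∪_; ⁅_⁆; ∣_∣)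
open import Data.Product using (Σ; ∃; _×_)
open import Relation.Binary.PropositionalEquality using (_≡_; _≢_)

record RGraph (r n : ℕ) : Set₁ where
  field
    Edge    : Subset n → Set
    uniform : ∀ e → Edge e → ∣ e ∣ ≡ r
open RGraph public

CoversPairs : ∀ {r n} → RGraph r n → Set
CoversPairs {n = n} G =
  ∀ (u v : Fin n) → u ≢ v → ∃ λ e → Edge G e × u ∈ e × v ∈ e

Link : ∀ {r n} → RGraph r n → Fin n → Subset n → Set
Link G x e = x ∉ e × Edge G (e ∪ ⁅ x ⁆)

-- H (edge predicate on Fin n) contains the linear star L^r_t as a subgraph:
-- a centre v and t edges containing v which pairwise meet exactly in {v}.
-- (Uniformity r is inherited from H.)
ContainsLinearStar : ∀ {n} → (Subset n → Set) → ℕ → Set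
ContainsLinearStar {n} H t =
  Σ (Fin n) λ v → Σ (Fin t → Subset n) λ f →
    (∀ i → H (f i)) × (∀ i → v ∈ f i) ×
    (∀ i j → i ≢ j → f i ∩ f j ≡ ⁅ v ⁆)

ContainsComplete : ∀ {n} → (Subset n → Set) → (s p : ℕ) → Set
ContainsComplete {n} H s p =
  Σ (Subset n) λ S → ∣ S ∣ ≡ p × (∀ e → e ⊆ S → ∣ e ∣ ≡ s → H e)

-- Let S span a copy of K^{r-1}_{t(r-1)-1} in the link of x.  Then x ∉ S, so
-- S ∪ {x} has t(r-1) < n vertices and some y lies outside it.  An edge e
-- through x and y meets S in at most r-2 vertices, so S ∖ e still contains
-- t-1 pairwise disjoint (r-1)-sets; each of them together with x is an edge,
-- and with e these t edges form a linear star centred at x.  A copy of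
-- K^r_{t(r-1)} on S gives such a link clique on S - x for any x ∈ S.
module Submission where

open import Defs
open import Data.Nat using (ℕ; zero; suc; _≤_; _<_; _+_; _*_; _∸_; z≤n; s≤s; s≤s⁻¹)
open import Data.Nat.Properties
  using (≤-trans; ≤-reflexive; +-comm; +-suc; +-cancelˡ-≤; +-monoʳ-≤; suc-injective;
         m<n⇒0<n∸m; m≤m+n; m≤n+m; module ≤-Reasoning)
open import Data.Fin using (Fin; zero; suc)
open import Data.Fin.Subset
  using (Subset; Nonempty; outside; inside; _∈_; _∉_; _⊆_; _∩_; _∪_; _─_; _-_; ⁅_⁆; ⊥; ∣_∣)
open import Data.Fin.Subset.Properties
open import Data.Vec using ([]; _∷_; here; there)
open import Data.Vec.Functional using () renaming (_∷_ to _◂_)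
open import Data.Product using (Σ; ∃; _×_; _,_; proj₁; proj₂)
open import Data.Sum using (inj₁; inj₂)
open import Function using (_∘_)
open import Relation.Binary.PropositionalEquality
open import Relation.Nullary using (¬_; contradiction)

private
  variable
    n : ℕ
    x y : Fin n
    p q : Subset n

0<∣p∣⇒Nonempty : 0 < ∣ p ∣ → Nonempty p
0<∣p∣⇒Nonempty {p = inside ∷ p} _ = zero , here
0<∣p∣⇒Nonempty {p = outside ∷ p} 0<∣p∣ =
  let x , x∈p = 0<∣p∣⇒Nonempty 0<∣p∣ in suc x , there x∈p

∣p∣<n⇒∃∉ : ∀ (p : Subset n) → ∣ p ∣ < n → ∃ λ x → x ∉ p
∣p∣<n⇒∃∉ p ∣p∣<n =
  let x , x∈∁p = 0<∣p∣⇒Nonempty (subst (0 <_) (sym (∣∁p∣≡n∸∣p∣ p)) (m<n⇒0<n∸m ∣p∣<n))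
  in x , x∈∁p⇒x∉p x∈∁p

x∈p─q⇒x∉q : x ∈ p ─ q → x ∉ q
x∈p─q⇒x∉q {x = zero} {p = _ ∷ _} {q = inside ∷ _} () here
x∈p─q⇒x∉q {x = suc x} {p = _ ∷ _} {q = _ ∷ _} (there x∈p─q) (there x∈q) = x∈p─q⇒x∉q x∈p─q x∈q

x∈p⇒⁅x⁆⊆p : x ∈ p → ⁅ x ⁆ ⊆ p
x∈p⇒⁅x⁆⊆p {x = x} x∈p z∈⁅x⁆ rewrite x∈⁅y⁆⇒x≡y x z∈⁅x⁆ = x∈p

q⊆p-x⇒x∉q : q ⊆ p - x → x ∉ q
q⊆p-x⇒x∉q {x = x} q⊆p-x x∈q = x∈p─q⇒x∉q (q⊆p-x x∈q) (x∈⁅x⁆ x)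

q⊆p-x⇒q∪⁅x⁆⊆p : ∀ q → q ⊆ p - x → x ∈ p → q ∪ ⁅ x ⁆ ⊆ p
q⊆p-x⇒q∪⁅x⁆⊆p {p = p} {x = x} q q⊆p-x x∈p z∈q∪⁅x⁆ with x∈p∪q⁻ q ⁅ x ⁆ z∈q∪⁅x⁆
... | inj₁ z∈q = p─q⊆p p ⁅ x ⁆ (q⊆p-x z∈q)
... | inj₂ z∈⁅x⁆ = x∈p⇒⁅x⁆⊆p x∈p z∈⁅x⁆

y∉p∪⁅x⁆⇒x≢y : y ∉ p ∪ ⁅ x ⁆ → x ≢ y
y∉p∪⁅x⁆⇒x≢y {p = p} {x = x} y∉p∪⁅x⁆ refl = y∉p∪⁅x⁆ (q⊆p∪q p ⁅ x ⁆ (x∈⁅x⁆ x))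

q⊆p─r⇒r∩q≡⊥ : ∀ {r} → q ⊆ p ─ r → r ∩ q ≡ ⊥
q⊆p─r⇒r∩q≡⊥ {q = q} {r = r} q⊆p─r = Empty-unique λ (z , z∈r∩q) →
  let z∈r , z∈q = x∈p∩q⁻ r q z∈r∩q in x∈p─q⇒x∉q (q⊆p─r z∈q) z∈r

q⊆p⇒p∩q≡q : q ⊆ p → p ∩ q ≡ q
q⊆p⇒p∩q≡q {q = q} {p = p} q⊆p =
  ⊆-antisym (p∩q⊆q p q) (λ z∈q → x∈p∩q⁺ (q⊆p z∈q , z∈q))

∣p∣≡∣p─q∣+∣p∩q∣ : ∀ (p q : Subset n) → ∣ p ∣ ≡ ∣ p ─ q ∣ + ∣ p ∩ q ∣
∣p∣≡∣p─q∣+∣p∩q∣ [] [] = refl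
∣p∣≡∣p─q∣+∣p∩q∣ (inside ∷ p) (inside ∷ q) =
  trans (cong suc (∣p∣≡∣p─q∣+∣p∩q∣ p q)) (sym (+-suc _ _))
∣p∣≡∣p─q∣+∣p∩q∣ (inside ∷ p) (outside ∷ q) = cong suc (∣p∣≡∣p─q∣+∣p∩q∣ p q)
∣p∣≡∣p─q∣+∣p∩q∣ (outside ∷ p) (inside ∷ q) = ∣p∣≡∣p─q∣+∣p∩q∣ p q
∣p∣≡∣p─q∣+∣p∩q∣ (outside ∷ p) (outside ∷ q) = ∣p∣≡∣p─q∣+∣p∩q∣ p q

x∉p⇒∣p∪⁅x⁆∣≡1+∣p∣ : x ∉ p → ∣ p ∪ ⁅ x ⁆ ∣ ≡ suc ∣ p ∣
x∉p⇒∣p∪⁅x⁆∣≡1+∣p∣ {x = zero} {p = inside ∷ p} x∉p = contradiction here x∉p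
x∉p⇒∣p∪⁅x⁆∣≡1+∣p∣ {x = zero} {p = outside ∷ p} _ = cong (suc ∘ ∣_∣) (∪-identityʳ p)
x∉p⇒∣p∪⁅x⁆∣≡1+∣p∣ {x = suc x} {p = inside ∷ p} x∉p =
  cong suc (x∉p⇒∣p∪⁅x⁆∣≡1+∣p∣ (x∉p ∘ there))
x∉p⇒∣p∪⁅x⁆∣≡1+∣p∣ {x = suc x} {p = outside ∷ p} x∉p = x∉p⇒∣p∪⁅x⁆∣≡1+∣p∣ (x∉p ∘ there)

x∈p⇒∣p∣≡1+∣p-x∣ : x ∈ p → ∣ p ∣ ≡ suc ∣ p - x ∣
x∈p⇒∣p∣≡1+∣p-x∣ {p = inside ∷ p} here = cong (suc ∘ ∣_∣) (sym (p─⊥≡p p))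
x∈p⇒∣p∣≡1+∣p-x∣ {p = inside ∷ p} (there x∈p) = cong suc (x∈p⇒∣p∣≡1+∣p-x∣ x∈p)
x∈p⇒∣p∣≡1+∣p-x∣ {p = outside ∷ p} (there x∈p) = x∈p⇒∣p∣≡1+∣p-x∣ x∈p

∉⇒2+∣p∩q∣≤∣q∣ : x ∈ q → y ∈ q → x ≢ y → x ∉ p → y ∉ p → 2 + ∣ p ∩ q ∣ ≤ ∣ q ∣
∉⇒2+∣p∩q∣≤∣q∣ {x = x} {q = q} {y = y} {p = p} x∈q y∈q x≢y x∉p y∉p = begin
  2 + ∣ p ∩ q ∣       ≤⟨ s≤s (s≤s (p⊆q⇒∣p∣≤∣q∣ p∩q⊆q-x-y)) ⟩
  2 + ∣ q - x - y ∣   ≡⟨ cong suc (sym (x∈p⇒∣p∣≡1+∣p-x∣ y∈q-x)) ⟩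
  1 + ∣ q - x ∣       ≡⟨ sym (x∈p⇒∣p∣≡1+∣p-x∣ x∈q) ⟩
  ∣ q ∣               ∎
  where
  open ≤-Reasoning
  y∈q-x : y ∈ q - x
  y∈q-x = x∈p∧x≢y⇒x∈p-y y∈q (x≢y ∘ sym)
  p∩q⊆q-x-y : p ∩ q ⊆ q - x - y
  p∩q⊆q-x-y {z} z∈p∩q =
    let z∈p , z∈q = x∈p∩q⁻ p q z∈p∩q
    in x∈p∧x≢y⇒x∈p-y (x∈p∧x≢y⇒x∈p-y z∈q λ { refl → x∉p z∈p }) λ { refl → y∉p z∈p }

m+k≤∣p∣⇒k≤∣p─q∣ : ∀ {m k} (p q : Subset n) → m + k ≤ ∣ p ∣ → ∣ p ∩ q ∣ ≤ m → k ≤ ∣ p ─ q ∣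
m+k≤∣p∣⇒k≤∣p─q∣ {m = m} {k} p q m+k≤∣p∣ ∣p∩q∣≤m = +-cancelˡ-≤ m k ∣ p ─ q ∣ (begin
  m + k                  ≤⟨ m+k≤∣p∣ ⟩
  ∣ p ∣                  ≡⟨ ∣p∣≡∣p─q∣+∣p∩q∣ p q ⟩
  ∣ p ─ q ∣ + ∣ p ∩ q ∣  ≤⟨ +-monoʳ-≤ ∣ p ─ q ∣ ∣p∩q∣≤m ⟩
  ∣ p ─ q ∣ + m          ≡⟨ +-comm ∣ p ─ q ∣ m ⟩
  m + ∣ p ─ q ∣          ∎)
  where open ≤-Reasoning

⊆-ofSize : ∀ m (p : Subset n) → m ≤ ∣ p ∣ → ∃ λ q → q ⊆ p × ∣ q ∣ ≡ m
⊆-ofSize {n} zero p _ = ⊥ , ⊥⊆ , ∣⊥∣≡0 n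
⊆-ofSize (suc m) (outside ∷ p) m<∣p∣ =
  let q , q⊆p , ∣q∣≡m = ⊆-ofSize (suc m) p m<∣p∣ in outside ∷ q , out⊆ q⊆p , ∣q∣≡m
⊆-ofSize (suc m) (inside ∷ p) (s≤s m≤∣p∣) =
  let q , q⊆p , ∣q∣≡m = ⊆-ofSize m p m≤∣p∣ in inside ∷ q , in⊆in q⊆p , cong suc ∣q∣≡m

∋-⊆-ofSize : ∀ {m} → x ∈ p → suc m ≤ ∣ p ∣ → ∃ λ q → q ⊆ p × x ∈ q × ∣ q ∣ ≡ suc m
∋-⊆-ofSize {x = x} {p = p} {m} x∈p m<∣p∣
  with ⊆-ofSize m (p - x) (s≤s⁻¹ (subst (suc m ≤_) (x∈p⇒∣p∣≡1+∣p-x∣ x∈p) m<∣p∣))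
... | q , q⊆p-x , ∣q∣≡m =
  q ∪ ⁅ x ⁆ , q⊆p-x⇒q∪⁅x⁆⊆p q q⊆p-x x∈p , q⊆p∪q q ⁅ x ⁆ (x∈⁅x⁆ x) ,
  trans (x∉p⇒∣p∪⁅x⁆∣≡1+∣p∣ (q⊆p-x⇒x∉q q⊆p-x)) (cong suc ∣q∣≡m)

PairwiseMeetIn : ∀ {k} → Subset n → (Fin k → Subset n) → Set
PairwiseMeetIn c f = ∀ i j → i ≢ j → f i ∩ f j ≡ c

◂-pairwiseMeetIn : ∀ {k c a} {f : Fin k → Subset n} →
  (∀ i → a ∩ f i ≡ c) → PairwiseMeetIn c f → PairwiseMeetIn c (a ◂ f)
◂-pairwiseMeetIn a∩f≡c f-meet zero zero i≢j = contradiction refl i≢j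
◂-pairwiseMeetIn a∩f≡c f-meet zero (suc j) _ = a∩f≡c j
◂-pairwiseMeetIn {a = a} {f} a∩f≡c f-meet (suc i) zero _ = trans (∩-comm (f i) a) (a∩f≡c i)
◂-pairwiseMeetIn a∩f≡c f-meet (suc i) (suc j) i≢j = f-meet i j (i≢j ∘ cong suc)

∪-pairwiseMeetIn : ∀ {k} c {f : Fin k → Subset n} →
  PairwiseMeetIn ⊥ f → PairwiseMeetIn c (λ i → f i ∪ c)
∪-pairwiseMeetIn c {f} f-disjoint i j i≢j = begin
  (f i ∪ c) ∩ (f j ∪ c)  ≡⟨ ∪-distribʳ-∩ c (f i) (f j) ⟨
  (f i ∩ f j) ∪ c        ≡⟨ cong (_∪ c) (f-disjoint i j i≢j) ⟩
  ⊥ ∪ c                  ≡⟨ ∪-identityˡ c ⟩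
  c                      ∎
  where open ≡-Reasoning

∩-∪-disjoint : ∀ {a b} (c : Subset n) → a ∩ b ≡ ⊥ → c ⊆ a → a ∩ (b ∪ c) ≡ c
∩-∪-disjoint {a = a} {b} c a∩b≡⊥ c⊆a = begin
  a ∩ (b ∪ c)        ≡⟨ ∩-distribˡ-∪ a b c ⟩
  (a ∩ b) ∪ (a ∩ c)  ≡⟨ cong₂ _∪_ a∩b≡⊥ (q⊆p⇒p∩q≡q c⊆a) ⟩
  ⊥ ∪ c              ≡⟨ ∪-identityˡ c ⟩
  c                  ∎
  where open ≡-Reasoning

disjoint-⊆-ofSize : ∀ k m (p : Subset n) → k * m ≤ ∣ p ∣ →
  Σ (Fin k → Subset n) λ f → (∀ i → f i ⊆ p) × (∀ i → ∣ f i ∣ ≡ m) × PairwiseMeetIn ⊥ f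
disjoint-⊆-ofSize zero m p _ = (λ ()) , (λ ()) , (λ ()) , λ ()
disjoint-⊆-ofSize (suc k) m p m+km≤∣p∣
  with ⊆-ofSize m p (≤-trans (m≤m+n m (k * m)) m+km≤∣p∣)
... | q , q⊆p , ∣q∣≡m
  with disjoint-⊆-ofSize k m (p ─ q)
         (m+k≤∣p∣⇒k≤∣p─q∣ p q m+km≤∣p∣ (≤-trans (∣p∩q∣≤∣q∣ p q) (≤-reflexive ∣q∣≡m)))
... | f , f⊆p─q , ∣f∣≡m , f-disjoint =
  q ◂ f ,
  (λ { zero → q⊆p ; (suc i) → p─q⊆p p q ∘ f⊆p─q i }) ,
  (λ { zero → ∣q∣≡m ; (suc i) → ∣f∣≡m i }) ,
  ◂-pairwiseMeetIn (λ i → q⊆p─r⇒r∩q≡⊥ (f⊆p─q i)) f-disjoint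

LinkClique : ∀ {r} → RGraph r n → Fin n → ℕ → Subset n → Set
LinkClique G x s S = ∀ e → e ⊆ S → ∣ e ∣ ≡ s → Link G x e

linkClique-∌ : ∀ {r s} (G : RGraph r n) {x S} → LinkClique G x (suc s) S → suc s ≤ ∣ S ∣ → x ∉ S
linkClique-∌ G clique s<∣S∣ x∈S =
  let e , e⊆S , x∈e , ∣e∣≡ = ∋-⊆-ofSize x∈S s<∣S∣ in proj₁ (clique e e⊆S ∣e∣≡) x∈e

clique⇒linkClique : ∀ {r s k} (G : RGraph r n) →
  ContainsComplete (Edge G) (suc s) (suc k) → ∃ λ x → ContainsComplete (Link G x) s k
clique⇒linkClique G (S , ∣S∣≡1+k , clique) =
  let x , x∈S = 0<∣p∣⇒Nonempty (subst (0 <_) (sym ∣S∣≡1+k) (s≤s z≤n))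
  in x , S - x , suc-injective (trans (sym (x∈p⇒∣p∣≡1+∣p-x∣ x∈S)) ∣S∣≡1+k) ,
     λ e e⊆S-x ∣e∣≡s → let x∉e = q⊆p-x⇒x∉q e⊆S-x in
       x∉e , clique (e ∪ ⁅ x ⁆) (q⊆p-x⇒q∪⁅x⁆⊆p e e⊆S-x x∈S)
                    (trans (x∉p⇒∣p∪⁅x⁆∣≡1+∣p∣ x∉e) (cong suc ∣e∣≡s))

∃edge∋-∣∩∣≤ : ∀ {m} (G : RGraph (2 + m) n) {x S} → CoversPairs G → x ∉ S → suc ∣ S ∣ < n →
  ∃ λ e → Edge G e × x ∈ e × ∣ S ∩ e ∣ ≤ m
∃edge∋-∣∩∣≤ {n} G {x} {S} covers x∉S 2+∣S∣≤n
  with ∣p∣<n⇒∃∉ (S ∪ ⁅ x ⁆) (subst (_< n) (sym (x∉p⇒∣p∪⁅x⁆∣≡1+∣p∣ x∉S)) 2+∣S∣≤n)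
... | y , y∉S∪⁅x⁆ with covers x y (y∉p∪⁅x⁆⇒x≢y y∉S∪⁅x⁆)
... | e , e∈G , x∈e , y∈e = e , e∈G , x∈e , s≤s⁻¹ (s≤s⁻¹ (≤-trans
  (∉⇒2+∣p∩q∣≤∣q∣ x∈e y∈e (y∉p∪⁅x⁆⇒x≢y y∉S∪⁅x⁆) x∉S (y∉S∪⁅x⁆ ∘ p⊆p∪q ⁅ x ⁆))
  (≤-reflexive (uniform G e e∈G))))

linkClique⇒linearStar : ∀ {r m k} (G : RGraph r n) {x e S} → Edge G e → x ∈ e →
  m + k * suc m ≤ ∣ S ∣ → ∣ S ∩ e ∣ ≤ m → LinkClique G x (suc m) S →
  ContainsLinearStar (Edge G) (suc k)
linkClique⇒linearStar {m = m} {k} G {x} {e} {S} e∈G x∈e ∣S∣-large ∣S∩e∣≤m clique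
  with disjoint-⊆-ofSize k (suc m) (S ─ e) (m+k≤∣p∣⇒k≤∣p─q∣ S e ∣S∣-large ∣S∩e∣≤m)
... | f , f⊆S─e , ∣f∣≡ , f-disjoint =
  x , e ◂ (λ i → f i ∪ ⁅ x ⁆) ,
  (λ { zero → e∈G ; (suc i) → proj₂ (clique (f i) (p─q⊆p S e ∘ f⊆S─e i) (∣f∣≡ i)) }) ,
  (λ { zero → x∈e ; (suc i) → q⊆p∪q (f i) ⁅ x ⁆ (x∈⁅x⁆ x) }) ,
  ◂-pairwiseMeetIn
    (λ i → ∩-∪-disjoint ⁅ x ⁆ (q⊆p─r⇒r∩q≡⊥ (f⊆S─e i)) (x∈p⇒⁅x⁆⊆p x∈e))
    (∪-pairwiseMeetIn ⁅ x ⁆ f-disjoint)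

lemma4p2 : ∀ (r t n : ℕ) → 2 ≤ r → 2 ≤ t → (G : RGraph r n) →
    t * (r ∸ 1) + 1 ≤ n →
    ¬ ContainsLinearStar (Edge G) t →
    CoversPairs G →
    (∀ (x : Fin n) → ¬ ContainsComplete (Link G x) (r ∸ 1) (t * (r ∸ 1) ∸ 1))
    × ¬ ContainsComplete (Edge G) r (t * (r ∸ 1))
lemma4p2 (suc (suc m)) (suc (suc k)) n (s≤s (s≤s z≤n)) (s≤s (s≤s z≤n)) G n-large no-star covers =
  no-linkClique , no-clique
  where
  -- t (r - 1) - 1 reduces to m + (k + 1)(m + 1) for r = m + 2, t = k + 2.
  no-linkClique : ∀ x → ¬ ContainsComplete (Link G x) (suc m) (m + suc k * suc m)
  no-linkClique x (S , ∣S∣≡ , clique) =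
    let e , e∈G , x∈e , ∣S∩e∣≤m = ∃edge∋-∣∩∣≤ G covers x∉S 2+∣S∣≤n
    in no-star (linkClique⇒linearStar G e∈G x∈e (≤-reflexive (sym ∣S∣≡)) ∣S∩e∣≤m clique)
    where
    open ≤-Reasoning
    x∉S : x ∉ S
    x∉S = linkClique-∌ G clique (begin
      suc m                ≤⟨ m≤m+n (suc m) (k * suc m) ⟩
      suc k * suc m        ≤⟨ m≤n+m (suc k * suc m) m ⟩
      m + suc k * suc m    ≡⟨ ∣S∣≡ ⟨
      ∣ S ∣                ∎)
    2+∣S∣≤n : 2 + ∣ S ∣ ≤ n
    2+∣S∣≤n = begin
      2 + ∣ S ∣                  ≡⟨ cong (2 +_) ∣S∣≡ ⟩
      2 + (m + suc k * suc m)    ≡⟨ cong suc (+-comm 1 (m + suc k * suc m)) ⟩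
      suc (suc k) * suc m + 1    ≤⟨ n-large ⟩
      n                          ∎

  no-clique : ¬ ContainsComplete (Edge G) (suc (suc m)) (suc (suc k) * suc m)
  no-clique K = let x , link-K = clique⇒linkClique G K in no-linkClique x link-K
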